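{- Let $n, r \geq 1$ and $\ell \in \mathbb{Z}$, and let \[ \psi_{(r,n)}(x) = \sum_{k=0}^{r-1} \binom{n+k}{k} (-1)^k (x-1)^{r-1-k}. \] Then for every $d \in \{1,\ldots,r\}$, \[ r!\, \psi_{(r,n)}(\ell) \equiv r!\, \ell^{d-1} (\ell-1)^{r-d} \pmod{n+d}. \] -}

module Defs where

open import Data.Nat as ℕ using (ℕ; zero; suc)
open import Data.Nat.Combinatorics using (_C_)
open import Data.Integer as ℤ using (ℤ; +_; _+_; _-_; _*_; _^_; -_; 1ℤ; 0ℤ)

sign : ℕ → ℤ
sign k = (- 1ℤ) ^ k

sumTo : ℕ → (ℕ → ℤ) → ℤ
sumTo zero    f = 0ℤ
sumTo (suc m) f = sumTo m f + f m

ψ : ℕ → ℕ → ℤ → ℤ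
ψ r n x = sumTo r (λ k → + ((n ℕ.+ k) C k) * sign k * (x - 1ℤ) ^ (r ℕ.∸ 1 ℕ.∸ k))

infix 4 _≡ᵢ_[mod_]
_≡ᵢ_[mod_] : ℤ → ℤ → ℕ → Set
a ≡ᵢ b [mod m ] = (+ m) ID.∣ (a - b)
  where import Data.Integer.Divisibility as ID

-- Put d = m + 1 and N = n + m + 1. Since n + j ≡ -(m + 1 - j) (mod N), the rising product
-- (n+1)⋯(n+k) = k! C(n+k,k) is congruent to (-1)^k m(m-1)⋯(m-k+1) = (-1)^k k! C(m,k).
-- Multiplying by r!/k! (k < r) turns every term of r! ψ into r! C(m,k) (ℓ-1)^(r-1-k), and by
-- the binomial theorem these sum to r! ℓ^m (ℓ-1)^(r-d), as C(m,k) = 0 for k > m.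

module Submission where

open import Defs
open import Data.Nat as ℕ using (ℕ; _≤_; _!)
open import Data.Integer as ℤ using (ℤ; +_; _*_; _-_; _^_; 1ℤ)

open import Data.Fin using (toℕ)
open import Data.Fin.Properties using (toℕ-inject₁; toℕ-fromℕ)
open import Data.Integer using (_+_; -_; 0ℤ)
open import Data.Integer.Divisibility.Signed using (_∣_; divides; ∣m⇒∣-m; ∣m∣n⇒∣m+n; ∣n⇒∣m*n; ∣ᵤ⇒∣; ∣⇒∣ᵤ)
open import Data.Integer.Tactic.RingSolver using (solve-∀)
open import Data.Nat using (zero; suc; _<_; s≤s)
open import Data.Nat.Combinatorics using (_C_; nCk≡nPk/k!)
open import Data.Nat.Combinatorics.Base using (_P_; _P′_)
open import Data.Nat.Combinatorics.Specification using (k>n⇒nCk≡0; k!∣nP′k; nPk≡n!/[n∸k]!; nP′k≡n!/[n∸k]!)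
open import Data.Nat.DivMod using (_/_; m*[n/m]≡n)
import Data.Nat.Divisibility as ℕ
import Data.Nat.Properties as ℕ
import Data.Integer.Properties as ℤ
open import Data.Product using (_,_)
open import Data.Sum using (inj₁; inj₂)
open import Data.Vec.Functional using (init; last)
open import Level using (0ℓ)
open import Relation.Binary.Bundles using (Setoid)
open import Relation.Binary.Core using (Rel)
open import Relation.Binary.PropositionalEquality
open import Relation.Binary.Structures using (IsEquivalence)
open import Relation.Nullary using (yes; no)
import Relation.Binary.Reasoning.Setoid

open import Algebra.Properties.CommutativeSemigroup ℕ.*-commutativeSemigroup using (x∙yz≈y∙xz)

import Algebra.Definitions.RawMonoid ℤ.+-0-rawMonoid as Additive
import Algebra.Definitions.RawMonoid ℤ.*-1-rawMonoid as Multiplicative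
import Algebra.Properties.CommutativeSemiring.Binomial ℤ.+-*-commutativeSemiring as Binomial
open import Algebra.Properties.Monoid.Sum ℤ.+-0-monoid using (sum; sum-init-last; sum-cong-≗)

[1+n]P′[1+k]≡[1+n]*nP′k : ∀ n k → suc n P′ suc k ≡ suc n ℕ.* (n P′ k)
[1+n]P′[1+k]≡[1+n]*nP′k n zero    = refl
[1+n]P′[1+k]≡[1+n]*nP′k n (suc k) = trans
  (cong ((n ℕ.∸ k) ℕ.*_) ([1+n]P′[1+k]≡[1+n]*nP′k n k))
  (x∙yz≈y∙xz (n ℕ.∸ k) (suc n) (n P′ k))

k>n⇒nP′k≡0 : ∀ {n k} → n < k → n P′ k ≡ 0
k>n⇒nP′k≡0 {n} {suc k} (s≤s n≤k) with ℕ.m≤n⇒m<n∨m≡n n≤k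
... | inj₁ n<k  = trans (cong ((n ℕ.∸ k) ℕ.*_) (k>n⇒nP′k≡0 n<k)) (ℕ.*-zeroʳ (n ℕ.∸ k))
... | inj₂ refl = cong (ℕ._* (n P′ n)) (ℕ.n∸n≡0 n)

k!*nCk≡nP′k : ∀ n k → k ! ℕ.* (n C k) ≡ n P′ k
k!*nCk≡nP′k n k with k ℕ.≤? n
... | yes k≤n = begin
  k ! ℕ.* (n C k)          ≡⟨ cong (k ! ℕ.*_) (nCk≡nPk/k! k≤n) ⟩
  k ! ℕ.* ((n P k) / k !)  ≡⟨ cong (λ p → k ! ℕ.* (p / k !)) nPk≡nP′k ⟩
  k ! ℕ.* ((n P′ k) / k !) ≡⟨ m*[n/m]≡n (k!∣nP′k k≤n) ⟩
  n P′ k                   ∎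
  where
  open ≡-Reasoning
  instance _ = k ℕ.!≢0
  nPk≡nP′k : n P k ≡ n P′ k
  nPk≡nP′k = trans (nPk≡n!/[n∸k]! k≤n) (sym (nP′k≡n!/[n∸k]! k≤n))
... | no k≰n rewrite k>n⇒nCk≡0 (ℕ.≰⇒> k≰n) | k>n⇒nP′k≡0 (ℕ.≰⇒> k≰n) = ℕ.*-zeroʳ (k !)

sumTo-cong : ∀ s {f g : ℕ → ℤ} → (∀ k → k < s → f k ≡ g k) → sumTo s f ≡ sumTo s g
sumTo-cong zero    f≡g = refl
sumTo-cong (suc s) f≡g =
  cong₂ _+_ (sumTo-cong s (λ k k<s → f≡g k (ℕ.m<n⇒m<1+n k<s))) (f≡g s ℕ.≤-refl)

sumTo-+ : ∀ s t (f : ℕ → ℤ) → sumTo (s ℕ.+ t) f ≡ sumTo s f + sumTo t (λ j → f (s ℕ.+ j))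
sumTo-+ s zero    f rewrite ℕ.+-identityʳ s = sym (ℤ.+-identityʳ (sumTo s f))
sumTo-+ s (suc t) f rewrite ℕ.+-suc s t =
  trans (cong (_+ f (s ℕ.+ t)) (sumTo-+ s t f)) (ℤ.+-assoc (sumTo s f) _ _)

sumTo-zero : ∀ s → sumTo s (λ _ → 0ℤ) ≡ 0ℤ
sumTo-zero zero    = refl
sumTo-zero (suc s) = trans (ℤ.+-identityʳ _) (sumTo-zero s)

*-distribˡ-sumTo : ∀ c s (f : ℕ → ℤ) → c * sumTo s f ≡ sumTo s (λ k → c * f k)
*-distribˡ-sumTo c zero    f = ℤ.*-zeroʳ c
*-distribˡ-sumTo c (suc s) f =
  trans (ℤ.*-distribˡ-+ c (sumTo s f) (f s)) (cong (_+ c * f s) (*-distribˡ-sumTo c s f))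

*-distribʳ-sumTo : ∀ c s (f : ℕ → ℤ) → sumTo s f * c ≡ sumTo s (λ k → f k * c)
*-distribʳ-sumTo c s f = trans (ℤ.*-comm (sumTo s f) c)
  (trans (*-distribˡ-sumTo c s f) (sumTo-cong s (λ k _ → ℤ.*-comm c (f k))))

sumTo≡sum : ∀ s (f : ℕ → ℤ) → sumTo s f ≡ sum {s} (λ i → f (toℕ i))
sumTo≡sum zero    f = refl
sumTo≡sum (suc s) f = begin
  sumTo s f + f s
    ≡⟨ cong₂ _+_ (trans (sumTo≡sum s f) (sum-cong-≗ {s} λ i → cong f (sym (toℕ-inject₁ i))))
                 (cong f (sym (toℕ-fromℕ s))) ⟩
  sum {s} (init (λ i → f (toℕ i))) + last (λ i → f (toℕ i))
    ≡⟨ sum-init-last {s} (λ i → f (toℕ i)) ⟨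
  sum {suc s} (λ i → f (toℕ i)) ∎
  where open ≡-Reasoning

-- The algebra library writes multiples and powers in a semiring as iterated sums and products.
×≡* : ∀ k x → k Additive.× x ≡ + k * x
×≡* zero    x = sym (ℤ.*-zeroˡ x)
×≡* (suc k) x = trans (cong (_+_ x) (×≡* k x)) (sym (ℤ.suc-* (+ k) x))

×≡^ : ∀ k x → k Multiplicative.× x ≡ x ^ k
×≡^ zero    x = refl
×≡^ (suc k) x = cong (x *_) (×≡^ k x)

binomial : ∀ y m → sumTo (suc m) (λ k → + (m C k) * y ^ (m ℕ.∸ k)) ≡ (1ℤ + y) ^ m
binomial y m = begin
  sumTo (suc m) (λ k → + (m C k) * y ^ (m ℕ.∸ k))
    ≡⟨ sumTo≡sum (suc m) _ ⟩
  sum {suc m} (λ i → + (m C toℕ i) * y ^ (m ℕ.∸ toℕ i))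
    ≡⟨ sum-cong-≗ {suc m} term ⟨
  Binomial.binomialExpansion 1ℤ y m
    ≡⟨ Binomial.theorem m 1ℤ y ⟨
  m Multiplicative.× (1ℤ + y)
    ≡⟨ ×≡^ m (1ℤ + y) ⟩
  (1ℤ + y) ^ m ∎
  where
  open ≡-Reasoning
  term : ∀ i → Binomial.binomialTerm 1ℤ y m i ≡ + (m C toℕ i) * y ^ (m ℕ.∸ toℕ i)
  term i = trans (×≡* (m C toℕ i) _) (cong (+ (m C toℕ i) *_) (begin
    toℕ i Multiplicative.× 1ℤ * (m ℕ.∸ toℕ i) Multiplicative.× y
      ≡⟨ cong₂ _*_ (trans (×≡^ (toℕ i) 1ℤ) (ℤ.^-zeroˡ (toℕ i))) (×≡^ (m ℕ.∸ toℕ i) y) ⟩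
    1ℤ * y ^ (m ℕ.∸ toℕ i)
      ≡⟨ ℤ.*-identityˡ _ ⟩
    y ^ (m ℕ.∸ toℕ i) ∎))

binomial-padded : ∀ y m t →
  sumTo (suc m ℕ.+ t) (λ k → + (m C k) * y ^ (m ℕ.+ t ℕ.∸ k)) ≡ (1ℤ + y) ^ m * y ^ t
binomial-padded y m t = begin
  sumTo (suc m ℕ.+ t) term
    ≡⟨ sumTo-+ (suc m) t term ⟩
  sumTo (suc m) term + sumTo t (λ j → term (suc m ℕ.+ j))
    ≡⟨ cong₂ _+_ (sumTo-cong (suc m) head) (trans (sumTo-cong t (λ j _ → tail j)) (sumTo-zero t)) ⟩
  sumTo (suc m) (λ k → + (m C k) * y ^ (m ℕ.∸ k) * y ^ t) + 0ℤ
    ≡⟨ ℤ.+-identityʳ _ ⟩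
  sumTo (suc m) (λ k → + (m C k) * y ^ (m ℕ.∸ k) * y ^ t)
    ≡⟨ *-distribʳ-sumTo (y ^ t) (suc m) _ ⟨
  sumTo (suc m) (λ k → + (m C k) * y ^ (m ℕ.∸ k)) * y ^ t
    ≡⟨ cong (_* y ^ t) (binomial y m) ⟩
  (1ℤ + y) ^ m * y ^ t ∎
  where
  open ≡-Reasoning
  term : ℕ → ℤ
  term k = + (m C k) * y ^ (m ℕ.+ t ℕ.∸ k)
  head : ∀ k → k < suc m → term k ≡ + (m C k) * y ^ (m ℕ.∸ k) * y ^ t
  head k (s≤s k≤m) = begin
    + (m C k) * y ^ (m ℕ.+ t ℕ.∸ k)       ≡⟨ cong (λ e → + (m C k) * y ^ e) (ℕ.+-∸-comm t k≤m) ⟩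
    + (m C k) * y ^ (m ℕ.∸ k ℕ.+ t)       ≡⟨ cong (+ (m C k) *_) (ℤ.^-distribˡ-+-* y (m ℕ.∸ k) t) ⟩
    + (m C k) * (y ^ (m ℕ.∸ k) * y ^ t)   ≡⟨ ℤ.*-assoc (+ (m C k)) _ _ ⟨
    + (m C k) * y ^ (m ℕ.∸ k) * y ^ t     ∎
  tail : ∀ j → term (suc m ℕ.+ j) ≡ 0ℤ
  tail j rewrite k>n⇒nCk≡0 (s≤s (ℕ.m≤m+n m j)) = ℤ.*-zeroˡ (y ^ (m ℕ.+ t ℕ.∸ (suc m ℕ.+ j)))

module Modulo (N : ℤ) where

  infix 4 _≈_
  _≈_ : Rel ℤ 0ℓ
  a ≈ b = N ∣ a - b

  ≈-refl : ∀ {a} → a ≈ a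
  ≈-refl {a} = subst (N ∣_) (sym (ℤ.+-inverseʳ a)) (divides 0ℤ (sym (ℤ.*-zeroˡ N)))

  ≈-sym : ∀ {a b} → a ≈ b → b ≈ a
  ≈-sym {a} {b} a≈b = subst (N ∣_) (neg-minus a b) (∣m⇒∣-m a≈b)
    where
    neg-minus : ∀ a b → - (a - b) ≡ b - a
    neg-minus = solve-∀

  ≈-trans : ∀ {a b c} → a ≈ b → b ≈ c → a ≈ c
  ≈-trans {a} {b} {c} a≈b b≈c = subst (N ∣_) (ℤ.+-minus-telescope a b c) (∣m∣n⇒∣m+n a≈b b≈c)

  ≈-isEquivalence : IsEquivalence _≈_
  ≈-isEquivalence = record
    { refl  = λ {a} → ≈-refl {a}
    ; sym   = λ {a} {b} → ≈-sym {a} {b}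
    ; trans = λ {a} {b} {c} → ≈-trans {a} {b} {c}
    }

  ≈-setoid : Setoid 0ℓ 0ℓ
  ≈-setoid = record { isEquivalence = ≈-isEquivalence }

  *-congˡ : ∀ c {a b} → a ≈ b → c * a ≈ c * b
  *-congˡ c {a} {b} a≈b = subst (N ∣_) (distrib c a b) (∣n⇒∣m*n c a≈b)
    where
    distrib : ∀ c a b → c * (a - b) ≡ c * a - c * b
    distrib = solve-∀

  sumTo-cong-≈ : ∀ s {f g} → (∀ k → k < s → f k ≈ g k) → sumTo s f ≈ sumTo s g
  sumTo-cong-≈ zero    f≈g = ≈-refl {0ℤ}
  sumTo-cong-≈ (suc s) {f} {g} f≈g =
    subst (N ∣_) (interchange (sumTo s f) (f s) (sumTo s g) (g s))
      (∣m∣n⇒∣m+n (sumTo-cong-≈ s (λ k k<s → f≈g k (ℕ.m<n⇒m<1+n k<s))) (f≈g s ℕ.≤-refl))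
    where
    interchange : ∀ a b c d → (a - c) + (b - d) ≡ (a + b) - (c + d)
    interchange = solve-∀

  module ≈-Reasoning = Relation.Binary.Reasoning.Setoid ≈-setoid

module _ (n m : ℕ) where

  open Modulo (+ (n ℕ.+ suc m))

  n+1+m∣[n+1+k+[m∸k]]*mP′k : ∀ k → n ℕ.+ suc m ℕ.∣ (suc (n ℕ.+ k) ℕ.+ (m ℕ.∸ k)) ℕ.* (m P′ k)
  n+1+m∣[n+1+k+[m∸k]]*mP′k k with ℕ.≤-<-connex k m
  ... | inj₁ k≤m =
    subst (λ a → n ℕ.+ suc m ℕ.∣ a ℕ.* (m P′ k)) (sym n+1+k+[m∸k]≡n+1+m) (ℕ.m∣m*n (m P′ k))
    where
    n+1+k+[m∸k]≡n+1+m : suc (n ℕ.+ k) ℕ.+ (m ℕ.∸ k) ≡ n ℕ.+ suc m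
    n+1+k+[m∸k]≡n+1+m = begin
      suc (n ℕ.+ k ℕ.+ (m ℕ.∸ k))    ≡⟨ cong suc (ℕ.+-assoc n k (m ℕ.∸ k)) ⟩
      suc (n ℕ.+ (k ℕ.+ (m ℕ.∸ k)))  ≡⟨ cong (λ a → suc (n ℕ.+ a)) (ℕ.m+[n∸m]≡n k≤m) ⟩
      suc (n ℕ.+ m)                  ≡⟨ ℕ.+-suc n m ⟨
      n ℕ.+ suc m                    ∎
      where open ≡-Reasoning
  ... | inj₂ m<k = ℕ.∣n⇒∣m*n (suc (n ℕ.+ k) ℕ.+ (m ℕ.∸ k))
    (subst (n ℕ.+ suc m ℕ.∣_) (sym (k>n⇒nP′k≡0 m<k)) (ℕ._∣0 (n ℕ.+ suc m)))

  -[n+1+k]*mP′k≈mP′[1+k] : ∀ k → - + suc (n ℕ.+ k) * + (m P′ k) ≈ + (m P′ suc k)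
  -[n+1+k]*mP′k≈mP′[1+k] k =
    subst (+ (n ℕ.+ suc m) ∣_) difference (∣m⇒∣-m (∣ᵤ⇒∣ (n+1+m∣[n+1+k+[m∸k]]*mP′k k)))
    where
    a b x : ℕ
    a = suc (n ℕ.+ k)
    b = m ℕ.∸ k
    x = m P′ k
    distrib : ∀ a b x → - ((a + b) * x) ≡ - a * x - b * x
    distrib = solve-∀
    difference : - + ((a ℕ.+ b) ℕ.* x) ≡ - + a * + x - + (b ℕ.* x)
    difference = begin
      - + ((a ℕ.+ b) ℕ.* x)      ≡⟨ cong -_ (trans (ℤ.pos-* (a ℕ.+ b) x) (cong (_* + x) (ℤ.pos-+ a b))) ⟩
      - ((+ a + + b) * + x)      ≡⟨ distrib (+ a) (+ b) (+ x) ⟩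
      - + a * + x - + b * + x    ≡⟨ cong (_-_ (- + a * + x)) (ℤ.pos-* b x) ⟨
      - + a * + x - + (b ℕ.* x)  ∎
      where open ≡-Reasoning

  ±[n+k]P′k≈mP′k : ∀ k → sign k * + ((n ℕ.+ k) P′ k) ≈ + (m P′ k)
  ±[n+k]P′k≈mP′k zero    = ≈-refl {1ℤ}
  ±[n+k]P′k≈mP′k (suc k) = begin
    sign (suc k) * + ((n ℕ.+ suc k) P′ suc k)
      ≡⟨ cong (λ p → sign (suc k) * + p) [n+1+k]P′[1+k]≡[n+1+k]*[n+k]P′k ⟩
    sign (suc k) * + (suc (n ℕ.+ k) ℕ.* ((n ℕ.+ k) P′ k))
      ≡⟨ cong (sign (suc k) *_) (ℤ.pos-* (suc (n ℕ.+ k)) _) ⟩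
    - 1ℤ * sign k * (+ suc (n ℕ.+ k) * + ((n ℕ.+ k) P′ k))
      ≡⟨ rearrange (sign k) (+ suc (n ℕ.+ k)) _ ⟩
    - + suc (n ℕ.+ k) * (sign k * + ((n ℕ.+ k) P′ k))
      ≈⟨ *-congˡ (- + suc (n ℕ.+ k)) {sign k * + ((n ℕ.+ k) P′ k)} (±[n+k]P′k≈mP′k k) ⟩
    - + suc (n ℕ.+ k) * + (m P′ k)
      ≈⟨ -[n+1+k]*mP′k≈mP′[1+k] k ⟩
    + (m P′ suc k) ∎
    where
    open ≈-Reasoning
    [n+1+k]P′[1+k]≡[n+1+k]*[n+k]P′k : (n ℕ.+ suc k) P′ suc k ≡ suc (n ℕ.+ k) ℕ.* ((n ℕ.+ k) P′ k)
    [n+1+k]P′[1+k]≡[n+1+k]*[n+k]P′k =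
      trans (cong (_P′ suc k) (ℕ.+-suc n k)) ([1+n]P′[1+k]≡[1+n]*nP′k (n ℕ.+ k) k)
    rearrange : ∀ s a x → - 1ℤ * s * (a * x) ≡ - a * (s * x)
    rearrange = solve-∀

  r!*[n+k]Ck*±≈r!*mCk : ∀ {r k} → k ≤ r → (e : ℤ) →
    + (r !) * (+ ((n ℕ.+ k) C k) * sign k * e) ≈ + (r !) * (+ (m C k) * e)
  r!*[n+k]Ck*±≈r!*mCk {r} {k} k≤r e with ℕ.m≤n⇒m!∣n! k≤r
  ... | ℕ.divides q r!≡q*k! = begin
    + (r !) * (+ ((n ℕ.+ k) C k) * sign k * e)
      ≡⟨ cong (_* (+ ((n ℕ.+ k) C k) * sign k * e)) +r!≡+q*+k! ⟩
    + q * + (k !) * (+ ((n ℕ.+ k) C k) * sign k * e)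
      ≡⟨ rearrange (+ q) (+ (k !)) (+ ((n ℕ.+ k) C k)) (sign k) e ⟩
    + q * e * (sign k * (+ (k !) * + ((n ℕ.+ k) C k)))
      ≡⟨ cong (λ z → + q * e * (sign k * z)) (trans (sym (ℤ.pos-* (k !) _)) (cong +_ (k!*nCk≡nP′k _ k))) ⟩
    + q * e * (sign k * + ((n ℕ.+ k) P′ k))
      ≈⟨ *-congˡ (+ q * e) {sign k * + ((n ℕ.+ k) P′ k)} (±[n+k]P′k≈mP′k k) ⟩
    + q * e * + (m P′ k)
      ≡⟨ cong (λ z → + q * e * z) (trans (cong +_ (sym (k!*nCk≡nP′k m k))) (ℤ.pos-* (k !) (m C k))) ⟩
    + q * e * (+ (k !) * + (m C k))
      ≡⟨ regroup (+ q) (+ (k !)) (+ (m C k)) e ⟩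
    + q * + (k !) * (+ (m C k) * e)
      ≡⟨ cong (_* (+ (m C k) * e)) +r!≡+q*+k! ⟨
    + (r !) * (+ (m C k) * e) ∎
    where
    open ≈-Reasoning
    +r!≡+q*+k! : + (r !) ≡ + q * + (k !)
    +r!≡+q*+k! = trans (cong +_ r!≡q*k!) (ℤ.pos-* q (k !))
    rearrange : ∀ q f c s e → q * f * (c * s * e) ≡ q * e * (s * (f * c))
    rearrange = solve-∀
    regroup : ∀ q f c e → q * e * (f * c) ≡ q * f * (c * e)
    regroup = solve-∀

  r!ψ≈r!ℓ^m[ℓ-1]^t : ∀ t ℓ → let r = suc m ℕ.+ t in
    + (r !) * ψ r n ℓ ≈ + (r !) * ℓ ^ m * (ℓ - 1ℤ) ^ t
  r!ψ≈r!ℓ^m[ℓ-1]^t t ℓ = begin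
    + (r !) * ψ r n ℓ
      ≡⟨ *-distribˡ-sumTo (+ (r !)) r _ ⟩
    sumTo r (λ k → + (r !) * (+ ((n ℕ.+ k) C k) * sign k * y ^ (m ℕ.+ t ℕ.∸ k)))
      ≈⟨ sumTo-cong-≈ r (λ k k<r → r!*[n+k]Ck*±≈r!*mCk (ℕ.<⇒≤ k<r) (y ^ (m ℕ.+ t ℕ.∸ k))) ⟩
    sumTo r (λ k → + (r !) * (+ (m C k) * y ^ (m ℕ.+ t ℕ.∸ k)))
      ≡⟨ *-distribˡ-sumTo (+ (r !)) r _ ⟨
    + (r !) * sumTo r (λ k → + (m C k) * y ^ (m ℕ.+ t ℕ.∸ k))
      ≡⟨ cong (+ (r !) *_) (binomial-padded y m t) ⟩
    + (r !) * ((1ℤ + y) ^ m * y ^ t)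
      ≡⟨ cong (λ z → + (r !) * (z ^ m * y ^ t)) (1+[x-1]≡x ℓ) ⟩
    + (r !) * (ℓ ^ m * y ^ t)
      ≡⟨ ℤ.*-assoc (+ (r !)) (ℓ ^ m) (y ^ t) ⟨
    + (r !) * ℓ ^ m * y ^ t ∎
    where
    open ≈-Reasoning
    r : ℕ
    r = suc m ℕ.+ t
    y : ℤ
    y = ℓ - 1ℤ
    1+[x-1]≡x : ∀ x → 1ℤ + (x - 1ℤ) ≡ x
    1+[x-1]≡x = solve-∀

lemma5p3 : (n r : ℕ) → 1 ≤ n → 1 ≤ r → (ℓ : ℤ) → (d : ℕ) → 1 ≤ d → d ≤ r →
    (+ (r !)) * ψ r n ℓ ≡ᵢ (+ (r !)) * ℓ ^ (d ℕ.∸ 1) * (ℓ - 1ℤ) ^ (r ℕ.∸ d) [mod (n ℕ.+ d) ]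
lemma5p3 n r _ _ ℓ zero    () _
lemma5p3 n r _ _ ℓ (suc m) _  d≤r with ℕ.m≤n⇒∃[o]m+o≡n d≤r
... | t , refl rewrite ℕ.m+n∸m≡n m t = ∣⇒∣ᵤ (r!ψ≈r!ℓ^m[ℓ-1]^t n m t ℓ)
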